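{- Let $M\ge0$, $\mu\in\operatorname{Fil}^M\mathbf{D}_k(\mathbb{Z}_p)$ and $s\ge1$. For every integer $t$ with $0\le t\le s(k-1)$, $$\mathcal{U}_p^s(\mu)\in p^{s(k-1)-t}\operatorname{Fil}^{M+t}\mathbf{D}_k(\mathbb{Z}_p).$$ In particular, if $s(k-1)\ge2$, then $\mathcal{U}_p^s(\mu)\in p\operatorname{Fil}^{M+1}\mathbf{D}_k(\mathbb{Z}_p)$.
   Context: $p$ is a prime, $k\ge2$ an integer. $\mathcal{D}$ is the space of $\mathbb{Q}_p$-linear forms on $\mathbb{Q}_p[z]$, $\mathcal{C}(\mu)=\sum_{j\ge0}\mu(z^j)w^j$; $\mathbf{D}_k(\mathbb{Z}_p)=\mathcal{C}^{ -1}(\mathbb{Z}_p[[w]])$. For $M\ge0$, $\operatorname{Fil}^M\mathbf{D}_k(\mathbb{Z}_p)$ is the set of $\mu$ with $\mathcal{C}(\mu)\in w^{k-1}\mathbb{Z}_p[[w]]$ and $\mu(z^{k-2+j})\in p^{M-j+1}\mathbb{Z}_p$ for $j=1,\dots,M$. For $\beta=\begin{pmatrix}a&b\\0&d\end{pmatrix}$, $(\mu|_k\beta)(z^n)=\int a^{k-2-n}(b+dz)^n\,d\mu$, and $\mathcal{U}_p(\mu)=\sum_{b=0}^{p-1}\mu|_k\begin{pmatrix}1&b\\0&p\end{pmatrix}$. -}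

module Defs where

open import Data.Nat as ℕ using (ℕ; zero; suc; _∸_)
open import Data.Nat.Combinatorics using (_C_)
open import Data.Integer as ℤ using (ℤ; +_; _-_)
open import Data.Integer.Divisibility.Signed using (_∣_; ∣m∣n⇒∣m+n; ∣n⇒∣m*n)
open import Data.Integer.Tactic.RingSolver using (solve-∀)
open import Data.List using (List; foldr; map; upTo)
open import Data.Product using (Σ; _×_)
open import Function using (_∘_)
open import Relation.Binary.PropositionalEquality using (_≡_; subst; sym)

-- The p-adic integers ℤ_p = lim_n ℤ/p^n, as coherent sequences of
-- integers: x (n+1) ≡ x n (mod p^n).  Equality is the setoid relation
-- "x n ≡ y n (mod p^n) for every n".

record ℤp (p : ℕ) : Set where
  constructor mkℤp
  field
    seq : ℕ → ℤ
    coh : ∀ n → (+ (p ℕ.^ n)) ∣ (seq (suc n) - seq n)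
open ℤp public

module _ {p : ℕ} where

  infix 4 _≈_
  _≈_ : ℤp p → ℤp p → Set
  x ≈ y = ∀ n → (+ (p ℕ.^ n)) ∣ (seq x n - seq y n)

  fromℤ : ℤ → ℤp p
  fromℤ c = mkℤp (λ _ → c) (λ n → subst (λ z → (+ (p ℕ.^ n)) ∣ z)
                                        (sym (lem c)) (∣n⇒∣m*n (+ 0) {+ 0} (∣n⇒∣m*n (+ 0) {+ 0} (record { quotient = + 0 ; equality = Relation.Binary.PropositionalEquality.refl }))))
    where
    open import Relation.Binary.PropositionalEquality using (refl)
    lem : ∀ c → c - c ≡ + 0 ℤ.* (+ 0 ℤ.* + 0)
    lem = solve-∀

  0p : ℤp p
  0p = fromℤ (+ 0)

  infixl 6 _+p_
  _+p_ : ℤp p → ℤp p → ℤp p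
  x +p y = mkℤp (λ n → seq x n ℤ.+ seq y n)
    (λ n → subst (λ z → (+ (p ℕ.^ n)) ∣ z)
                 (sym (lem (seq x (suc n)) (seq x n) (seq y (suc n)) (seq y n)))
                 (∣m∣n⇒∣m+n (coh x n) (coh y n)))
    where
    lem : ∀ a b c d → (a ℤ.+ c) - (b ℤ.+ d) ≡ (a - b) ℤ.+ (c - d)
    lem = solve-∀

  infixl 7 _·_
  _·_ : ℤ → ℤp p → ℤp p
  c · x = mkℤp (λ n → c ℤ.* seq x n)
    (λ n → subst (λ z → (+ (p ℕ.^ n)) ∣ z)
                 (sym (lem c (seq x (suc n)) (seq x n)))
                 (∣n⇒∣m*n c (coh x n)))
    where
    lem : ∀ c a b → c ℤ.* a - c ℤ.* b ≡ c ℤ.* (a - b)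
    lem = solve-∀

  sump : List (ℤp p) → ℤp p
  sump = foldr _+p_ 0p

  p^_∣p_ : ℕ → ℤp p → Set
  p^ m ∣p x = Σ (ℤp p) (λ y → x ≈ (+ (p ℕ.^ m)) · y)

-- Elements of D_k(ℤ_p): a linear form μ on ℚ_p[z] with C(μ) ∈ ℤ_p[[w]]
-- is determined by its moments μ(z^j) ∈ ℤ_p, so we represent it by the
-- moment sequence j ↦ μ(z^j).

Dk : ℕ → Set
Dk p = ℕ → ℤp p

-- μ |_k (1 b ; 0 d), via (μ|β)(z^n) = ∫ (b + d z)^n dμ
--   = Σ_{i=0}^{n} C(n,i) b^(n-i) d^i μ(z^i)    (here a = 1, so a^(k-2-n) = 1)
slash : {p : ℕ} → ℤ → ℤ → Dk p → Dk p
slash b d μ n =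
  sump (map (λ i → ((+ (n C i)) ℤ.* (b ℤ.^ (n ∸ i)) ℤ.* (d ℤ.^ i)) · μ i)
            (upTo (suc n)))

Up : {p : ℕ} → Dk p → Dk p
Up {p} μ n = sump (map (λ b → slash (+ b) (+ p) μ n) (upTo p))

Up^ : {p : ℕ} → ℕ → Dk p → Dk p
Up^ zero    μ = μ
Up^ (suc s) μ = Up (Up^ s μ)

-- μ ∈ Fil^M D_k(ℤ_p):
--   C(μ) ∈ w^(k-1) ℤ_p[[w]]  (μ(z^j) = 0 for j < k-1), and
--   μ(z^(k-2+j)) ∈ p^(M-j+1) ℤ_p  for j = 1, …, M.
InFil : {p : ℕ} → (k M : ℕ) → Dk p → Set
InFil k M μ =
  (∀ j → j ℕ.< k ∸ 1 → μ j ≈ 0p) ×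
  (∀ j → 1 ℕ.≤ j → j ℕ.≤ M → p^ (M ∸ j ℕ.+ 1) ∣p μ (k ∸ 2 ℕ.+ j))

InPFil : {p : ℕ} → (k m N : ℕ) → Dk p → Set
InPFil {p} k m N μ =
  Σ (Dk p) (λ ν → InFil k N ν × (∀ j → μ j ≈ (+ (p ℕ.^ m)) · ν j))

-- Write K = k − 1.  A distribution in Fil^M vanishes on z^n for n < K and
-- has n-th moment divisible by p^(M + K − n) for n ≥ K.  The n-th moment of
-- U_p μ is a ℤ-combination of the terms p^i μ(z^i) with i ≤ n, so if μ(z^i)
-- is divisible by p^(a + N + K − i) then every moment of U_p μ is divisible
-- by p^(a + N + K), which is at least p^(K + a + N + K − n) for n ≥ K: each
-- U_p gains a factor p^K while keeping the vanishing below K.  After s steps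
-- the n-th moment is divisible by p^(sK + M + K − n) = p^(sK − t) p^((M + t) + K − n),
-- which places U_p^s μ in p^(sK − t) Fil^(M + t).
module Submission where

open import Defs
open import Data.Nat using (ℕ; _+_; _*_; _∸_; _≤_)
open import Data.Nat.Primality using (Prime)
open import Data.Product using (_×_)

open import Data.Nat as ℕ using (zero; suc; _<_; _<?_; _≤?_; s≤s; z≤n; z<s; s≤s⁻¹)
open import Data.Nat.Properties
  using ( ≤-reflexive; ≤-<-trans; ≮⇒≥; ≰⇒>; <⇒≱
        ; +-monoʳ-≤; +-monoˡ-≤; +-comm; +-assoc; +-suc; +-identityʳ; ∸-monoʳ-≤; m+n∸n≡m
        ; m≤n+m∸n; m<m+n; m+[n∸m]≡n; m∸n+n≡m; m≤n⇒m∸n≡0; m≤n+o⇒m∸n≤o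
        ; [m+n]∸[m+o]≡n∸o; +-∸-comm; ^-distribˡ-+-*; module ≤-Reasoning)
open import Data.Integer as ℤ using (ℤ; +_; _-_)
open import Data.Integer.Properties using (pos-*; *-zeroʳ; *-identityˡ; *-assoc; *-distribˡ-+; +-inverseʳ)
open import Data.Integer.Divisibility.Signed using (_∣_; ∣m∣n⇒∣m+n; ∣n⇒∣m*n)
open import Data.Integer.Tactic.RingSolver using (solve-∀)
open import Data.Nat.Combinatorics using (_C_)
open import Data.List using (List; []; _∷_; map; upTo)
open import Data.List.Relation.Unary.All using (All; []; _∷_)
open import Data.List.Relation.Unary.All.Properties using (applyUpTo⁺₁)
open import Data.Product using (Σ-syntax; _,_; proj₁; proj₂)
open import Data.Empty using (⊥-elim)
open import Function using (id)
open import Relation.Nullary using (Dec; yes; no)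
open import Relation.Binary.PropositionalEquality
  using (_≡_; refl; sym; trans; cong; cong₂; subst; module ≡-Reasoning)

pos-^ : ∀ m n → + (m ℕ.^ n) ≡ (+ m) ℤ.^ n
pos-^ m zero    = refl
pos-^ m (suc n) = trans (pos-* m (m ℕ.^ n)) (cong (+ m ℤ.*_) (pos-^ m n))

pos-^-+ : ∀ m a b → + (m ℕ.^ (a + b)) ≡ + (m ℕ.^ a) ℤ.* + (m ℕ.^ b)
pos-^-+ m a b = trans (cong +_ (^-distribˡ-+-* m a b)) (pos-* (m ℕ.^ a) (m ℕ.^ b))

+-∸-≤ : ∀ m n o → m + n ∸ o ≤ m + (n ∸ o)
+-∸-≤ m n o = m≤n+o⇒m∸n≤o (m + n) o (begin
  m + n             ≤⟨ +-monoʳ-≤ m (m≤n+m∸n n o) ⟩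
  m + (o + (n ∸ o)) ≡⟨ swap m o (n ∸ o) ⟩
  o + (m + (n ∸ o)) ∎)
  where
  open ≤-Reasoning
  swap : ∀ a b c → a + (b + c) ≡ b + (a + c)
  swap a b c = trans (sym (+-assoc a b c)) (trans (cong (_+ c) (+-comm a b)) (+-assoc b a c))

m∸[1+n]+1≡m∸n : ∀ {m n} → suc n ≤ m → m ∸ suc n + 1 ≡ m ∸ n
m∸[1+n]+1≡m∸n {m} {n} 1+n≤m =
  trans (sym (+-∸-comm 1 1+n≤m)) (cong (_∸ suc n) (+-comm m 1))

[m+1+k]∸[k+1+j]≡m∸j : ∀ m k j → m + suc k ∸ (k + suc j) ≡ m ∸ j
[m+1+k]∸[k+1+j]≡m∸j m k j = begin
  m + suc k ∸ (k + suc j)  ≡⟨ cong₂ _∸_ (+-suc m k) (+-suc k j) ⟩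
  m + k ∸ (k + j)          ≡⟨ cong (_∸ (k + j)) (+-comm m k) ⟩
  k + m ∸ (k + j)          ≡⟨ [m+n]∸[m+o]≡n∸o k m j ⟩
  m ∸ j                    ∎
  where open ≡-Reasoning

module _ {p : ℕ} where

  -- _≈_ wrapped in a record, so that x and y can be inferred from x ≋ y.
  infix 4 _≋_
  record _≋_ (x y : ℤp p) : Set where
    constructor ≋⁺
    field ≋⇒≈ : x ≈ y
  open _≋_

  ≋-pointwise : {x y : ℤp p} → (∀ n → seq x n ≡ seq y n) → x ≋ y
  ≋-pointwise {x} {y} x≡y = ≋⁺ λ n → record
    { quotient = + 0
    ; equality = trans (cong (seq x n -_) (sym (x≡y n))) (+-inverseʳ (seq x n))
    }

  ≋-refl : {x : ℤp p} → x ≋ x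
  ≋-refl = ≋-pointwise λ _ → refl

  ≋-sym : {x y : ℤp p} → x ≋ y → y ≋ x
  ≋-sym {x} {y} (≋⁺ x≈y) = ≋⁺ λ n →
    subst (+ (p ℕ.^ n) ∣_) (lemma (seq x n) (seq y n)) (∣n⇒∣m*n (ℤ.- + 1) (x≈y n))
    where
    lemma : ∀ a b → ℤ.- + 1 ℤ.* (a - b) ≡ b - a
    lemma = solve-∀

  ≋-trans : {x y z : ℤp p} → x ≋ y → y ≋ z → x ≋ z
  ≋-trans {x} {y} {z} (≋⁺ x≈y) (≋⁺ y≈z) = ≋⁺ λ n →
    subst (+ (p ℕ.^ n) ∣_) (lemma (seq x n) (seq y n) (seq z n)) (∣m∣n⇒∣m+n (x≈y n) (y≈z n))
    where
    lemma : ∀ a b c → (a - b) ℤ.+ (b - c) ≡ a - c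
    lemma = solve-∀

  +p-cong : {x x′ y y′ : ℤp p} → x ≋ x′ → y ≋ y′ → x +p y ≋ x′ +p y′
  +p-cong {x} {x′} {y} {y′} (≋⁺ x≈x′) (≋⁺ y≈y′) = ≋⁺ λ n →
    subst (+ (p ℕ.^ n) ∣_) (lemma (seq x n) (seq x′ n) (seq y n) (seq y′ n))
          (∣m∣n⇒∣m+n (x≈x′ n) (y≈y′ n))
    where
    lemma : ∀ a b c d → (a - b) ℤ.+ (c - d) ≡ (a ℤ.+ c) - (b ℤ.+ d)
    lemma = solve-∀

  ·-congʳ : (c : ℤ) {x y : ℤp p} → x ≋ y → c · x ≋ c · y
  ·-congʳ c {x} {y} (≋⁺ x≈y) = ≋⁺ λ n →
    subst (+ (p ℕ.^ n) ∣_) (lemma c (seq x n) (seq y n)) (∣n⇒∣m*n c (x≈y n))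
    where
    lemma : ∀ c a b → c ℤ.* (a - b) ≡ c ℤ.* a - c ℤ.* b
    lemma = solve-∀

  ·-distribˡ-+p : (c : ℤ) (x y : ℤp p) → c · (x +p y) ≋ c · x +p c · y
  ·-distribˡ-+p c x y = ≋-pointwise λ n → *-distribˡ-+ c (seq x n) (seq y n)

  ·-zeroʳ : (c : ℤ) → c · 0p ≋ 0p
  ·-zeroʳ c = ≋-pointwise λ _ → *-zeroʳ c

  +p-zero : {x y : ℤp p} → x ≋ 0p → y ≋ 0p → x +p y ≋ 0p
  +p-zero x≋0 y≋0 = ≋-trans (+p-cong x≋0 y≋0) (≋-pointwise λ _ → refl)

  ·-zero : (c : ℤ) {x : ℤp p} → x ≋ 0p → c · x ≋ 0p
  ·-zero c x≋0 = ≋-trans (·-congʳ c x≋0) (·-zeroʳ c)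

  infix 4 p^_∣ₚ_
  record p^_∣ₚ_ (e : ℕ) (x : ℤp p) : Set where
    constructor dividesₚ
    field
      quotient : ℤp p
      equality : x ≋ + (p ℕ.^ e) · quotient

  ∣ₚ⇒∣p : ∀ {e x} → p^ e ∣ₚ x → p^ e ∣p x
  ∣ₚ⇒∣p (dividesₚ y x≋p^e·y) = y , ≋⇒≈ x≋p^e·y

  ∣p⇒∣ₚ : ∀ {e x} → p^ e ∣p x → p^ e ∣ₚ x
  ∣p⇒∣ₚ (y , x≈p^e·y) = dividesₚ y (≋⁺ x≈p^e·y)

  ∣ₚ-respʳ : ∀ {e x y} → x ≋ y → p^ e ∣ₚ x → p^ e ∣ₚ y
  ∣ₚ-respʳ x≋y (dividesₚ z x≋p^e·z) = dividesₚ z (≋-trans (≋-sym x≋y) x≋p^e·z)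

  ∣ₚ-zero : ∀ {e x} → x ≋ 0p → p^ e ∣ₚ x
  ∣ₚ-zero {e} x≋0 = dividesₚ 0p (≋-trans x≋0 (≋-sym (·-zeroʳ (+ (p ℕ.^ e)))))

  p^0∣ₚ : ∀ x → p^ 0 ∣ₚ x
  p^0∣ₚ x = dividesₚ x (≋-pointwise λ n → sym (*-identityˡ (seq x n)))

  ∣ₚ-+p : ∀ {e x y} → p^ e ∣ₚ x → p^ e ∣ₚ y → p^ e ∣ₚ x +p y
  ∣ₚ-+p {e} (dividesₚ x′ x≋) (dividesₚ y′ y≋) =
    dividesₚ (x′ +p y′) (≋-trans (+p-cong x≋ y≋) (≋-sym (·-distribˡ-+p (+ (p ℕ.^ e)) x′ y′)))

  ∣ₚ-· : ∀ {e x} c → p^ e ∣ₚ x → p^ e ∣ₚ c · x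
  ∣ₚ-· {e} c (dividesₚ y x≋) = dividesₚ (c · y) (≋-trans (·-congʳ c x≋)
    (≋-pointwise λ n → lemma c (+ (p ℕ.^ e)) (seq y n)))
    where
    lemma : ∀ c a b → c ℤ.* (a ℤ.* b) ≡ a ℤ.* (c ℤ.* b)
    lemma = solve-∀

  p^·-∣ₚ : ∀ {e x} i → p^ e ∣ₚ x → p^ (i + e) ∣ₚ + (p ℕ.^ i) · x
  p^·-∣ₚ {e} i (dividesₚ y x≋) = dividesₚ y
    (≋-trans (·-congʳ (+ (p ℕ.^ i)) x≋) (≋-pointwise λ n →
      trans (sym (*-assoc (+ (p ℕ.^ i)) (+ (p ℕ.^ e)) (seq y n)))
            (cong (ℤ._* seq y n) (sym (pos-^-+ p i e)))))

  ∣ₚ-split : ∀ a {b x} → p^ (a + b) ∣ₚ x →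
             Σ[ y ∈ ℤp p ] (x ≋ + (p ℕ.^ a) · y × p^ b ∣ₚ y)
  ∣ₚ-split a {b} (dividesₚ z x≋) = + (p ℕ.^ b) · z , x≋p^a·y , dividesₚ z ≋-refl
    where
    x≋p^a·y = ≋-trans x≋ (≋-pointwise λ n →
      trans (cong (ℤ._* seq z n) (pos-^-+ p a b))
            (*-assoc (+ (p ℕ.^ a)) (+ (p ℕ.^ b)) (seq z n)))

  ∣ₚ-weaken : ∀ {e f x} → e ≤ f → p^ f ∣ₚ x → p^ e ∣ₚ x
  ∣ₚ-weaken {e} e≤f p^f∣x =
    let y , x≋p^e·y , _ = ∣ₚ-split e (subst (p^_∣ₚ _) (sym (m+[n∸m]≡n e≤f)) p^f∣x)
    in dividesₚ y x≋p^e·y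

  record IsSumClosed (Q : ℤp p → Set) : Set where
    field
      0p∈ : Q 0p
      +p∈ : ∀ {x y} → Q x → Q y → Q (x +p y)

  ≋0p-isSumClosed : IsSumClosed (_≋ 0p)
  ≋0p-isSumClosed = record { 0p∈ = ≋-refl ; +p∈ = +p-zero }

  ∣ₚ-isSumClosed : ∀ e → IsSumClosed (p^ e ∣ₚ_)
  ∣ₚ-isSumClosed e = record { 0p∈ = ∣ₚ-zero ≋-refl ; +p∈ = ∣ₚ-+p }

  module _ {Q : ℤp p → Set} (Q-closed : IsSumClosed Q) where
    open IsSumClosed Q-closed

    sump-closed : {A : Set} (f : A → ℤp p) {xs : List A} →
                  All (λ a → Q (f a)) xs → Q (sump (map f xs))
    sump-closed f []         = 0p∈
    sump-closed f (Qfx ∷ Qfxs) = +p∈ Qfx (sump-closed f Qfxs)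

    sum-upTo-closed : (f : ℕ → ℤp p) (m : ℕ) → (∀ i → i < m → Q (f i)) →
                      Q (sump (map f (upTo m)))
    sum-upTo-closed f m Qf = sump-closed f (applyUpTo⁺₁ id m (Qf _))

    -- (U_p μ)(z^n) = Σ_b Σ_{i ≤ n} C(n,i) b^(n−i) p^i μ(z^i)
    Up-closed : (μ : Dk p) (n : ℕ) →
                (∀ q i → i ≤ n → Q ((q ℤ.* (+ p) ℤ.^ i) · μ i)) → Q (Up μ n)
    Up-closed μ n Q-terms =
      sum-upTo-closed (λ b → slash (+ b) (+ p) μ n) p λ b _ →
      sum-upTo-closed (λ i → (+ (n C i) ℤ.* (+ b) ℤ.^ (n ∸ i) ℤ.* (+ p) ℤ.^ i) · μ i)
                      (suc n) λ i i<1+n →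
      Q-terms (+ (n C i) ℤ.* (+ b) ℤ.^ (n ∸ i)) i (s≤s⁻¹ i<1+n)

  Up-vanishes : ∀ K (μ : Dk p) → (∀ i → i < K → μ i ≋ 0p) →
                ∀ n → n < K → Up μ n ≋ 0p
  Up-vanishes K μ μ-vanishes n n<K = Up-closed ≋0p-isSumClosed μ n λ q i i≤n →
    ·-zero (q ℤ.* (+ p) ℤ.^ i) (μ-vanishes i (≤-<-trans i≤n n<K))

  -- The factor p^i of the i-th term makes up for the missing divisibility of μ(z^i).
  Up-divisible : ∀ c (μ : Dk p) → (∀ i → p^ (c ∸ i) ∣ₚ μ i) → ∀ n → p^ c ∣ₚ Up μ n
  Up-divisible c μ μ-divisible n = Up-closed (∣ₚ-isSumClosed c) μ n λ q i _ →
    ∣ₚ-respʳ (term≋ q i)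
      (∣ₚ-· q (∣ₚ-weaken (m≤n+m∸n c i) (p^·-∣ₚ i (μ-divisible i))))
    where
    term≋ : ∀ q i → q · (+ (p ℕ.^ i) · μ i) ≋ (q ℤ.* (+ p) ℤ.^ i) · μ i
    term≋ q i = ≋-pointwise λ n →
      trans (sym (*-assoc q (+ (p ℕ.^ i)) (seq (μ i) n)))
            (cong (λ r → q ℤ.* r ℤ.* seq (μ i) n) (pos-^ p i))

  -- With K = k − 1 these are the conditions satisfied by the moments of the
  -- elements of p^a Fil^N; MomentBound K 0 M is exactly Fil^M.
  record MomentBound (K a N : ℕ) (μ : Dk p) : Set where
    field
      vanishes  : ∀ n → n < K → μ n ≋ 0p
      divisible : ∀ n → p^ (a + (N + K ∸ n)) ∣ₚ μ n

  Up-MomentBound : ∀ {K a N μ} → MomentBound K a N μ → MomentBound K (K + a) N (Up μ)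
  Up-MomentBound {K} {a} {N} {μ} bound = record
    { vanishes  = Up-vanishes K μ vanishes
    ; divisible = Up-μ-divisible
    }
    where
    open MomentBound bound
    Up-μ-divisible : ∀ n → p^ (K + a + (N + K ∸ n)) ∣ₚ Up μ n
    Up-μ-divisible n = by-cases (n <? K)
      where
      exponent-≤ : K ≤ n → K + a + (N + K ∸ n) ≤ a + (N + K)
      exponent-≤ K≤n = begin
        K + a + (N + K ∸ n) ≤⟨ +-monoʳ-≤ (K + a) (∸-monoʳ-≤ (N + K) K≤n) ⟩
        K + a + (N + K ∸ K) ≡⟨ cong (λ m → K + a + m) (m+n∸n≡m N K) ⟩
        K + a + N           ≡⟨ reorder K a N ⟩
        a + (N + K)         ∎
        where
        open ≤-Reasoning
        reorder : ∀ K a N → K + a + N ≡ a + (N + K)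
        reorder K a N = trans (cong (_+ N) (+-comm K a))
                              (trans (+-assoc a K N) (cong (_+_ a) (+-comm K N)))
      by-cases : Dec (n < K) → p^ (K + a + (N + K ∸ n)) ∣ₚ Up μ n
      by-cases (yes n<K) = ∣ₚ-zero (Up-vanishes K μ vanishes n n<K)
      by-cases (no n≮K)  = ∣ₚ-weaken (exponent-≤ (≮⇒≥ n≮K))
        (Up-divisible (a + (N + K)) μ (λ i → ∣ₚ-weaken (+-∸-≤ a (N + K) i) (divisible i)) n)

  Up^-MomentBound : ∀ {K a N μ} s → MomentBound K a N μ →
                    MomentBound K (s * K + a) N (Up^ s μ)
  Up^-MomentBound zero    bound = bound
  Up^-MomentBound {K} {a} {N} {μ} (suc s) bound =
    subst (λ b → MomentBound K b N (Up^ (suc s) μ)) (sym (+-assoc K (s * K) a))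
          (Up-MomentBound {μ = Up^ s μ} (Up^-MomentBound s bound))

  MomentBound-shift : ∀ {K a a′ t N μ} → a′ + t ≤ a →
                      MomentBound K a N μ → MomentBound K a′ (N + t) μ
  MomentBound-shift {K} {a} {a′} {t} {N} a′+t≤a bound = record
    { vanishes  = vanishes
    ; divisible = λ n → ∣ₚ-weaken (exponent-≤ n) (divisible n)
    }
    where
    open MomentBound bound
    exponent-≤ : ∀ n → a′ + (N + t + K ∸ n) ≤ a + (N + K ∸ n)
    exponent-≤ n = begin
      a′ + (N + t + K ∸ n)     ≡⟨ cong (λ m → a′ + (m ∸ n)) (reorder N t K) ⟩
      a′ + (t + (N + K) ∸ n)   ≤⟨ +-monoʳ-≤ a′ (+-∸-≤ t (N + K) n) ⟩
      a′ + (t + (N + K ∸ n))   ≡⟨ sym (+-assoc a′ t _) ⟩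
      a′ + t + (N + K ∸ n)     ≤⟨ +-monoˡ-≤ (N + K ∸ n) a′+t≤a ⟩
      a + (N + K ∸ n)          ∎
      where
      open ≤-Reasoning
      reorder : ∀ N t K → N + t + K ≡ t + (N + K)
      reorder N t K = trans (cong (_+ K) (+-comm N t)) (+-assoc t N K)

  InFil⇒MomentBound : ∀ {k′ M μ} → InFil (2 + k′) M μ → MomentBound (suc k′) 0 M μ
  InFil⇒MomentBound {k′} {M} {μ} (μ-vanishes , μ-divisible) = record
    { vanishes  = vanishes
    ; divisible = λ n → by-cases n (n ≤? k′)
    }
    where
    vanishes : ∀ n → n < suc k′ → μ n ≋ 0p
    vanishes n n<K = ≋⁺ (μ-vanishes n n<K)
    divisible-above : ∀ j → p^ (M + suc k′ ∸ (k′ + suc j)) ∣ₚ μ (k′ + suc j)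
    divisible-above j with suc j ≤? M
    ... | yes 1+j≤M = subst (p^_∣ₚ μ (k′ + suc j))
            (trans (m∸[1+n]+1≡m∸n 1+j≤M) (sym ([m+1+k]∸[k+1+j]≡m∸j M k′ j)))
            (∣p⇒∣ₚ (μ-divisible (suc j) (s≤s z≤n) 1+j≤M))
    ... | no 1+j≰M = subst (p^_∣ₚ μ (k′ + suc j))
            (trans (sym (m≤n⇒m∸n≡0 (s≤s⁻¹ (≰⇒> 1+j≰M)))) (sym ([m+1+k]∸[k+1+j]≡m∸j M k′ j)))
            (p^0∣ₚ (μ (k′ + suc j)))
    by-cases : ∀ n → Dec (n ≤ k′) → p^ (M + suc k′ ∸ n) ∣ₚ μ n
    by-cases n (yes n≤k′) = ∣ₚ-zero (vanishes n (s≤s n≤k′))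
    by-cases n (no n≰k′)  = subst (λ m → p^ (M + suc k′ ∸ m) ∣ₚ μ m)
      (trans (+-suc k′ (n ∸ suc k′)) (m+[n∸m]≡n (≰⇒> n≰k′))) (divisible-above (n ∸ suc k′))

  MomentBound⇒InPFil : ∀ {k′ a N μ} → MomentBound (suc k′) a N μ → InPFil (2 + k′) a N μ
  MomentBound⇒InPFil {k′} {a} {N} {μ} bound = ν , (ν-vanishes , ν-divisible) , μ≈p^a·ν
    where
    open MomentBound bound
    quotient-of : ∀ n → Σ[ y ∈ ℤp p ] (μ n ≋ + (p ℕ.^ a) · y × p^ (N + suc k′ ∸ n) ∣ₚ y)
    quotient-of n = ∣ₚ-split a (divisible n)
    -- Below K the quotient is chosen to be 0 (rather than the quotient supplied by
    -- divisibility), so that ν vanishes there without cancelling p^a in ℤ_p.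
    ν-at : ∀ n → Dec (n < suc k′) → ℤp p
    ν-at n (yes _) = 0p
    ν-at n (no _)  = proj₁ (quotient-of n)
    ν : Dk p
    ν n = ν-at n (n <? suc k′)

    ν-vanishes-at : ∀ n → n < suc k′ → (n<K? : Dec (n < suc k′)) → ν-at n n<K? ≋ 0p
    ν-vanishes-at n n<K (yes _)  = ≋-refl
    ν-vanishes-at n n<K (no n≮K) = ⊥-elim (n≮K n<K)
    ν-vanishes : ∀ n → n < suc k′ → ν n ≈ 0p
    ν-vanishes n n<K = ≋⇒≈ (ν-vanishes-at n n<K (n <? suc k′))

    ν-divisible-at : ∀ j → suc j ≤ N → (n<K? : Dec (k′ + suc j < suc k′)) →
                     p^ (N ∸ suc j + 1) ∣ₚ ν-at (k′ + suc j) n<K?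
    ν-divisible-at j _ (yes n<K) = ⊥-elim (<⇒≱ (m<m+n k′ z<s) (s≤s⁻¹ n<K))
    ν-divisible-at j 1+j≤N (no _) = subst (p^_∣ₚ proj₁ (quotient-of (k′ + suc j)))
      (trans ([m+1+k]∸[k+1+j]≡m∸j N k′ j) (sym (m∸[1+n]+1≡m∸n 1+j≤N)))
      (proj₂ (proj₂ (quotient-of (k′ + suc j))))
    ν-divisible : ∀ j → 1 ≤ j → j ≤ N → p^ (N ∸ j + 1) ∣p ν (k′ + j)
    ν-divisible (suc j) _ 1+j≤N = ∣ₚ⇒∣p (ν-divisible-at j 1+j≤N (k′ + suc j <? suc k′))

    μ≈p^a·ν-at : ∀ n → (n<K? : Dec (n < suc k′)) → μ n ≋ + (p ℕ.^ a) · ν-at n n<K?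
    μ≈p^a·ν-at n (yes n<K) = ≋-trans (vanishes n n<K) (≋-sym (·-zeroʳ (+ (p ℕ.^ a))))
    μ≈p^a·ν-at n (no _)    = proj₁ (proj₂ (quotient-of n))
    μ≈p^a·ν : ∀ n → μ n ≈ + (p ℕ.^ a) · ν n
    μ≈p^a·ν n = ≋⇒≈ (μ≈p^a·ν-at n (n <? suc k′))

mainTheorem7 : (p : ℕ) → Prime p → (k : ℕ) → 2 ≤ k →
    (M : ℕ) (μ : Dk p) → InFil k M μ → (s : ℕ) → 1 ≤ s →
    ((t : ℕ) → t ≤ s * (k ∸ 1) →
      InPFil k (s * (k ∸ 1) ∸ t) (M + t) (Up^ s μ))
    × (2 ≤ s * (k ∸ 1) → InPFil k 1 (M + 1) (Up^ s μ))
mainTheorem7 p _ (suc (suc k′)) (s≤s (s≤s z≤n)) M μ μ∈Fil s _ =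
  (λ t t≤sK → MomentBound⇒InPFil (MomentBound-shift (≤-reflexive (m∸n+n≡m t≤sK)) bound))
  , (λ 2≤sK → MomentBound⇒InPFil (MomentBound-shift {a′ = 1} {t = 1} 2≤sK bound))
  where
  bound : MomentBound (suc k′) (s * suc k′) M (Up^ s μ)
  bound = subst (λ a → MomentBound (suc k′) a M (Up^ s μ)) (+-identityʳ (s * suc k′))
                (Up^-MomentBound s (InFil⇒MomentBound μ∈Fil))
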